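{- Let $B\colon\mathcal{C}\to\mathcal{C}$ be an endofunctor which has a companion $(T,\tau)$ and a final coalgebra $(Z,\zeta)$. Let $\alpha\colon TZ\to Z$ be the algebra induced by $\tau$, i.e. the unique morphism with $\zeta\circ\alpha=B\alpha\circ\tau_Z\circ T\zeta$. Then coinduction up to $\alpha$ is valid: for every morphism $g\colon X\to BTX$ there is a unique $\hat g\colon X\to Z$ with $\zeta\circ\hat g=B\alpha\circ BT\hat g\circ g$.
   Context: The category $\mathrm{DL}(B)$ has as objects pairs $(F,\lambda)$ with $F\colon\mathcal{C}\to\mathcal{C}$ a functor and $\lambda\colon FB\Rightarrow BF$ a natural transformation; a morphism $(F,\lambda)\to(G,\rho)$ is a natural transformation $\kappa\colon F\Rightarrow G$ with $\rho\circ\kappa B=B\kappa\circ\lambda$. The companion of $B$ is a final object of $\mathrm{DL}(B)$. -}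

module Defs where

open import Level using (Level; _⊔_; suc)
open import Relation.Binary.Core using (Rel)
open import Relation.Binary.Structures using (IsEquivalence)
open import Data.Product using (Σ; _×_)

record Category (o ℓ e : Level) : Set (suc (o ⊔ ℓ ⊔ e)) where
  infixr 9 _∘_
  infix  4 _≈_
  field
    Obj       : Set o
    _⇒_       : Obj → Obj → Set ℓ
    _≈_       : ∀ {A B} → Rel (A ⇒ B) e
    id        : ∀ {A} → A ⇒ A
    _∘_       : ∀ {A B C} → B ⇒ C → A ⇒ B → A ⇒ C
    equiv     : ∀ {A B} → IsEquivalence (_≈_ {A} {B})
    assoc     : ∀ {A B C D} {f : A ⇒ B} {g : B ⇒ C} {h : C ⇒ D} →
                (h ∘ g) ∘ f ≈ h ∘ (g ∘ f)
    identityˡ : ∀ {A B} {f : A ⇒ B} → id ∘ f ≈ f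
    identityʳ : ∀ {A B} {f : A ⇒ B} → f ∘ id ≈ f
    ∘-resp-≈  : ∀ {A B C} {f h : B ⇒ C} {g i : A ⇒ B} →
                f ≈ h → g ≈ i → f ∘ g ≈ h ∘ i

module _ {o ℓ e : Level} (C : Category o ℓ e) where
  open Category C

  record Endofunctor : Set (o ⊔ ℓ ⊔ e) where
    field
      F₀           : Obj → Obj
      F₁           : ∀ {A B} → A ⇒ B → F₀ A ⇒ F₀ B
      identity     : ∀ {A} → F₁ (id {A}) ≈ id
      homomorphism : ∀ {A B D} {f : A ⇒ B} {g : B ⇒ D} →
                     F₁ (g ∘ f) ≈ F₁ g ∘ F₁ f
      F-resp-≈     : ∀ {A B} {f g : A ⇒ B} → f ≈ g → F₁ f ≈ F₁ g

  open Endofunctor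

  _·_ : Endofunctor → Endofunctor → Endofunctor
  F · G = record
    { F₀ = λ X → F₀ F (F₀ G X)
    ; F₁ = λ f → F₁ F (F₁ G f)
    ; identity = IsEquivalence.trans equiv (F-resp-≈ F (identity G)) (identity F)
    ; homomorphism = IsEquivalence.trans equiv (F-resp-≈ F (homomorphism G)) (homomorphism F)
    ; F-resp-≈ = λ p → F-resp-≈ F (F-resp-≈ G p)
    }

  record NatTrans (F G : Endofunctor) : Set (o ⊔ ℓ ⊔ e) where
    field
      η       : ∀ X → F₀ F X ⇒ F₀ G X
      commute : ∀ {X Y} (f : X ⇒ Y) → η Y ∘ F₁ F f ≈ F₁ G f ∘ η X

  open NatTrans

  _≈ₙ_ : ∀ {F G} → NatTrans F G → NatTrans F G → Set (o ⊔ e)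
  κ ≈ₙ κ' = ∀ X → η κ X ≈ η κ' X

  module _ (B : Endofunctor) where

    record DLObj : Set (o ⊔ ℓ ⊔ e) where
      constructor _,_
      field
        F   : Endofunctor
        lam : NatTrans (F · B) (B · F)

    record DLHom (P Q : DLObj) : Set (o ⊔ ℓ ⊔ e) where
      field
        κ      : NatTrans (DLObj.F P) (DLObj.F Q)
        compat : ∀ X → η (DLObj.lam Q) X ∘ η κ (F₀ B X)
                       ≈ F₁ B (η κ X) ∘ η (DLObj.lam P) X

    IsFinalDL : DLObj → Set (o ⊔ ℓ ⊔ e)
    IsFinalDL T = ∀ (P : DLObj) →
      Σ (DLHom P T) λ k → ∀ (k' : DLHom P T) → DLHom.κ k' ≈ₙ DLHom.κ k

    IsCompanion : DLObj → Set (o ⊔ ℓ ⊔ e)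
    IsCompanion = IsFinalDL

  ∃!⇒ : ∀ {p} {A B : Obj} → (A ⇒ B → Set p) → Set (ℓ ⊔ e ⊔ p)
  ∃!⇒ {A = A} {B} P = Σ (A ⇒ B) λ h → P h × (∀ (h' : A ⇒ B) → P h' → h' ≈ h)

  IsFinalCoalgebra : (B : Endofunctor) (Z : Obj) → Z ⇒ F₀ B Z → Set (o ⊔ ℓ ⊔ e)
  IsFinalCoalgebra B Z ζ =
    ∀ (X : Obj) (f : X ⇒ F₀ B X) → ∃!⇒ (λ (h : X ⇒ Z) → ζ ∘ h ≈ F₁ B h ∘ f)

module Submission where

-- The proof goes through monads and distributive laws.
--   1. DL(B) has identity objects, composites (F , λ) ⊗ (G , ρ) = (FG , λG ∘ Fρ),
--      composition and whiskering of morphisms, and unitors and an associator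
--      with identity components.
--   2. If (T , τ) is final in DL(B), the unique morphisms Id → T and T ⊗ T → T
--      make T a monad, and their compatibility with the distributive-law
--      components says that τ is a distributive law of this monad over B.
--      The monad laws are instances of uniqueness of morphisms into T.
--   3. For any monad T with a distributive law τ : TB ⇒ BT and a final coalgebra
--      (Z , ζ), the algebra α with ζα = Bα ∘ τ_Z ∘ Tζ is an Eilenberg–Moore
--      algebra, and every g : X → BTX lifts to the coalgebra Bμ ∘ τ ∘ Tg on TX.
--      The final morphism h out of this coalgebra is a T-algebra morphism, and
--      ĝ = h ∘ η solves g up to α; conversely for a solution k the extension
--      α ∘ Tk is a coalgebra morphism, so it equals h and k = h ∘ η.
-- The corollary is step 3 applied to the monad of step 2.

open import Level using (Level; _⊔_)
open import Data.Product using (_,_; proj₁; proj₂)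
open import Relation.Binary.Structures using (IsEquivalence)
open import Relation.Binary.Bundles using (Setoid)
import Relation.Binary.Reasoning.Setoid as SetoidReasoning
open import Defs

module _ {o ℓ e : Level} (C : Category o ℓ e) where
  open Category C
  open Endofunctor
  open NatTrans

  private
    variable
      P Q R S U V W X Y : Obj

  hom-setoid : Obj → Obj → Setoid ℓ e
  hom-setoid X Y = record { Carrier = X ⇒ Y ; _≈_ = _≈_ ; isEquivalence = equiv }

  module HomReasoning {X Y : Obj} = SetoidReasoning (hom-setoid X Y)
  open HomReasoning

  module HomEquivalence {X Y : Obj} = IsEquivalence (equiv {X} {Y})
  open HomEquivalence using ()
    renaming (refl to ≈-refl; sym to ≈-sym; trans to ≈-trans)

  infixr 4 _⟩∘⟨_
  infix 5 refl⟩∘⟨_ _⟩∘⟨refl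

  _⟩∘⟨_ : {f h : Y ⇒ W} {g i : X ⇒ Y} → f ≈ h → g ≈ i → f ∘ g ≈ h ∘ i
  _⟩∘⟨_ = ∘-resp-≈

  refl⟩∘⟨_ : {f : Y ⇒ W} {g i : X ⇒ Y} → g ≈ i → f ∘ g ≈ f ∘ i
  refl⟩∘⟨ p = ∘-resp-≈ ≈-refl p

  _⟩∘⟨refl : {f h : Y ⇒ W} {g : X ⇒ Y} → f ≈ h → f ∘ g ≈ h ∘ g
  p ⟩∘⟨refl = ∘-resp-≈ p ≈-refl

  pullˡ : {a : W ⇒ V} {b : Y ⇒ W} {c : Y ⇒ V} {f : X ⇒ Y} →
          a ∘ b ≈ c → a ∘ (b ∘ f) ≈ c ∘ f
  pullˡ p = ≈-trans (≈-sym assoc) (p ⟩∘⟨refl)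

  id-comm : {f : X ⇒ Y} → id ∘ f ≈ f ∘ id
  id-comm = ≈-trans identityˡ (≈-sym identityʳ)

  glue : {f : P ⇒ Q} {a : Q ⇒ R} {b : P ⇒ S} {g : S ⇒ R}
         {c : R ⇒ U} {d : S ⇒ V} {h : V ⇒ U} →
         a ∘ f ≈ g ∘ b → c ∘ g ≈ h ∘ d → (c ∘ a) ∘ f ≈ h ∘ (d ∘ b)
  glue {f = f} {a} {b} {g} {c} {d} {h} sq₁ sq₂ = begin
    (c ∘ a) ∘ f   ≈⟨ assoc ⟩
    c ∘ (a ∘ f)   ≈⟨ refl⟩∘⟨ sq₁ ⟩
    c ∘ (g ∘ b)   ≈⟨ pullˡ sq₂ ⟩
    (h ∘ d) ∘ b   ≈⟨ assoc ⟩
    h ∘ (d ∘ b)   ∎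

  F-square : (F : Endofunctor C) {a : Y ⇒ W} {b : X ⇒ Y} {c : V ⇒ W} {d : X ⇒ V} →
             a ∘ b ≈ c ∘ d → F₁ F a ∘ F₁ F b ≈ F₁ F c ∘ F₁ F d
  F-square F p = ≈-trans (≈-sym (homomorphism F))
                         (≈-trans (F-resp-≈ F p) (homomorphism F))

  F-pull : (F : Endofunctor C) {f : Y ⇒ W} {g : X ⇒ Y} {h : V ⇒ F₀ F X} →
           F₁ F f ∘ (F₁ F g ∘ h) ≈ F₁ F (f ∘ g) ∘ h
  F-pull F = pullˡ (≈-sym (homomorphism F))

  F-push : (F : Endofunctor C) {f : Y ⇒ W} {g : X ⇒ Y} {h : V ⇒ F₀ F X} →
           F₁ F (f ∘ g) ∘ h ≈ F₁ F f ∘ (F₁ F g ∘ h)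
  F-push F = ≈-sym (F-pull F)

  Id : Endofunctor C
  Id = record
    { F₀ = λ X → X ; F₁ = λ f → f
    ; identity = ≈-refl ; homomorphism = ≈-refl ; F-resp-≈ = λ p → p }

  module _ (B : Endofunctor C) where

    private
      B₁ : X ⇒ Y → F₀ B X ⇒ F₀ B Y
      B₁ = F₁ B

    κη : {P Q : DLObj C B} → DLHom C B P Q → (X : Obj) →
         F₀ (DLObj.F P) X ⇒ F₀ (DLObj.F Q) X
    κη k = η (DLHom.κ k)

    id-compat : {f g : X ⇒ F₀ B Y} → f ≈ g → f ∘ id ≈ B₁ id ∘ g
    id-compat p = ≈-trans identityʳ
                    (≈-trans p (≈-trans (≈-sym identityˡ) (≈-sym (identity B) ⟩∘⟨refl)))

    idDL : DLObj C B
    idDL = Id , record { η = λ X → id ; commute = λ f → id-comm }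

    infixr 6 _⊗_
    _⊗_ : DLObj C B → DLObj C B → DLObj C B
    (F , λF) ⊗ (G , λG) = _·_ C F G , record
      { η = λ X → η λF (F₀ G X) ∘ F₁ F (η λG X)
      ; commute = λ f → glue (F-square F (commute λG f)) (commute λF (F₁ G f)) }

    infixr 9 _∙_
    _∙_ : {P Q R : DLObj C B} → DLHom C B Q R → DLHom C B P Q → DLHom C B P R
    k ∙ j = record
      { κ = record
          { η = λ X → κη k X ∘ κη j X
          ; commute = λ f → glue (commute (DLHom.κ j) f) (commute (DLHom.κ k) f) }
      ; compat = λ X → ≈-trans
          (≈-sym (glue (≈-sym (DLHom.compat j X)) (≈-sym (DLHom.compat k X))))
          (≈-sym (homomorphism B) ⟩∘⟨refl) }

    infixr 7 _◁_
    _◁_ : (P : DLObj C B) {Q R : DLObj C B} → DLHom C B Q R → DLHom C B (P ⊗ Q) (P ⊗ R)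
    (F , λF) ◁ k = record
      { κ = record
          { η = λ X → F₁ F (κη k X)
          ; commute = λ f → F-square F (commute (DLHom.κ k) f) }
      ; compat = λ X → glue (F-square F (DLHom.compat k X)) (commute λF (κη k X)) }

    infixl 7 _▷_
    _▷_ : {P Q : DLObj C B} → DLHom C B P Q → (R : DLObj C B) → DLHom C B (P ⊗ R) (Q ⊗ R)
    k ▷ (G , λG) = record
      { κ = record
          { η = λ X → κη k (F₀ G X)
          ; commute = λ f → commute (DLHom.κ k) (F₁ G f) }
      ; compat = λ X → glue (≈-sym (commute (DLHom.κ k) (η λG X))) (DLHom.compat k (F₀ G X)) }

    unitorˡ : (P : DLObj C B) → DLHom C B (idDL ⊗ P) P
    unitorˡ P = record
      { κ = record { η = λ X → id ; commute = λ f → id-comm }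
      ; compat = λ X → id-compat (≈-sym identityˡ) }

    unitorʳ : (P : DLObj C B) → DLHom C B (P ⊗ idDL) P
    unitorʳ (F , λF) = record
      { κ = record { η = λ X → id ; commute = λ f → id-comm }
      ; compat = λ X → id-compat (≈-sym (≈-trans (refl⟩∘⟨ identity F) identityʳ)) }

    associator : (P Q R : DLObj C B) → DLHom C B (P ⊗ (Q ⊗ R)) ((P ⊗ Q) ⊗ R)
    associator (F , λF) (G , λG) (H , λH) = record
      { κ = record { η = λ X → id ; commute = λ f → id-comm }
      ; compat = λ X → id-compat (≈-trans assoc (refl⟩∘⟨ ≈-sym (homomorphism F))) }

    record DistributiveMonad : Set (o ⊔ ℓ ⊔ e) where
      field
        T    : Endofunctor C
        dist : NatTrans C (_·_ C T B) (_·_ C B T)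
        unit : ∀ X → X ⇒ F₀ T X
        mult : ∀ X → F₀ T (F₀ T X) ⇒ F₀ T X
        unit-natural : (f : X ⇒ Y) → unit Y ∘ f ≈ F₁ T f ∘ unit X
        mult-natural : (f : X ⇒ Y) → mult Y ∘ F₁ T (F₁ T f) ≈ F₁ T f ∘ mult X
        mult-unitˡ : ∀ X → mult X ∘ unit (F₀ T X) ≈ id
        mult-unitʳ : ∀ X → mult X ∘ F₁ T (unit X) ≈ id
        mult-assoc : ∀ X → mult X ∘ mult (F₀ T X) ≈ mult X ∘ F₁ T (mult X)
        dist-unit : ∀ X → η dist X ∘ unit (F₀ B X) ≈ B₁ (unit X)
        dist-mult : ∀ X → η dist X ∘ mult (F₀ B X)
                          ≈ B₁ (mult X) ∘ (η dist (F₀ T X) ∘ F₁ T (η dist X))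

    module CompanionMonad (T : DLObj C B) (final : IsCompanion C B T) where

      to-T : (P : DLObj C B) → DLHom C B P T
      to-T P = proj₁ (final P)

      final-unique : {P : DLObj C B} (k k' : DLHom C B P T) → ∀ X → κη k X ≈ κη k' X
      final-unique {P} k k' X = ≈-trans (proj₂ (final P) k X) (≈-sym (proj₂ (final P) k' X))

      unit-hom : DLHom C B idDL T
      unit-hom = to-T idDL

      mult-hom : DLHom C B (T ⊗ T) T
      mult-hom = to-T (T ⊗ T)

      companion-monad : DistributiveMonad
      companion-monad = record
        { T    = DLObj.F T
        ; dist = DLObj.lam T
        ; unit = κη unit-hom
        ; mult = κη mult-hom
        ; unit-natural = commute (DLHom.κ unit-hom)
        ; mult-natural = commute (DLHom.κ mult-hom)
        ; mult-unitˡ = final-unique (mult-hom ∙ (unit-hom ▷ T)) (unitorˡ T)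
        ; mult-unitʳ = final-unique (mult-hom ∙ (T ◁ unit-hom)) (unitorʳ T)
        ; mult-assoc = λ X → ≈-trans (refl⟩∘⟨ ≈-sym identityʳ)
            (final-unique (mult-hom ∙ (mult-hom ▷ T) ∙ associator T T T)
                          (mult-hom ∙ (T ◁ mult-hom)) X)
        ; dist-unit = λ X → ≈-trans (DLHom.compat unit-hom X) identityʳ
        ; dist-mult = DLHom.compat mult-hom
        }

    module CoinductionUpTo
        (M : DistributiveMonad)
        (Z : Obj) (ζ : Z ⇒ F₀ B Z) (final : IsFinalCoalgebra C B Z ζ)
        (α : F₀ (DistributiveMonad.T M) Z ⇒ Z)
        (α-eq : ζ ∘ α ≈ B₁ α ∘ (η (DistributiveMonad.dist M) Z
                                ∘ F₁ (DistributiveMonad.T M) ζ))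
        where
      open DistributiveMonad M

      private
        T₀ : Obj → Obj
        T₀ = F₀ T
        T₁ : X ⇒ Y → T₀ X ⇒ T₀ Y
        T₁ = F₁ T

      coalgebra-unique : (d : X ⇒ F₀ B X) {h h' : X ⇒ Z} →
                         ζ ∘ h ≈ B₁ h ∘ d → ζ ∘ h' ≈ B₁ h' ∘ d → h ≈ h'
      coalgebra-unique {X} d {h} {h'} p p' =
        ≈-trans (proj₂ (proj₂ (final X d)) h p) (≈-sym (proj₂ (proj₂ (final X d)) h' p'))

      distribute : W ⇒ F₀ B V → T₀ W ⇒ F₀ B (T₀ V)
      distribute {V = V} e = η dist V ∘ T₁ e

      distribute-∘ : {e : W ⇒ F₀ B V} {k : X ⇒ W} →
                     distribute e ∘ T₁ k ≈ distribute (e ∘ k)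
      distribute-∘ = ≈-trans assoc (refl⟩∘⟨ ≈-sym (homomorphism T))

      distribute-resp : {e e' : W ⇒ F₀ B V} → e ≈ e' → distribute e ≈ distribute e'
      distribute-resp p = refl⟩∘⟨ F-resp-≈ T p

      distribute-natural : {m : V ⇒ U} {d : W ⇒ F₀ B V} →
                           distribute (B₁ m ∘ d) ≈ B₁ (T₁ m) ∘ distribute d
      distribute-natural {m = m} {d} = begin
        η dist _ ∘ T₁ (B₁ m ∘ d)          ≈⟨ refl⟩∘⟨ homomorphism T ⟩
        η dist _ ∘ (T₁ (B₁ m) ∘ T₁ d)     ≈⟨ pullˡ (commute dist m) ⟩
        (B₁ (T₁ m) ∘ η dist _) ∘ T₁ d     ≈⟨ assoc ⟩
        B₁ (T₁ m) ∘ distribute d          ∎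

      distribute-unit : {e : W ⇒ F₀ B V} → distribute e ∘ unit W ≈ B₁ (unit V) ∘ e
      distribute-unit {W} {V} {e} = begin
        (η dist V ∘ T₁ e) ∘ unit W        ≈⟨ assoc ⟩
        η dist V ∘ (T₁ e ∘ unit W)        ≈⟨ refl⟩∘⟨ ≈-sym (unit-natural e) ⟩
        η dist V ∘ (unit (F₀ B V) ∘ e)    ≈⟨ pullˡ (dist-unit V) ⟩
        B₁ (unit V) ∘ e                   ∎

      distribute-mult : {e : W ⇒ F₀ B V} →
                        distribute e ∘ mult W ≈ B₁ (mult V) ∘ distribute (distribute e)
      distribute-mult {W} {V} {e} = begin
        (η dist V ∘ T₁ e) ∘ mult W                                 ≈⟨ assoc ⟩
        η dist V ∘ (T₁ e ∘ mult W)                                 ≈⟨ refl⟩∘⟨ ≈-sym (mult-natural e) ⟩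
        η dist V ∘ (mult (F₀ B V) ∘ T₁ (T₁ e))                     ≈⟨ pullˡ (dist-mult V) ⟩
        (B₁ (mult V) ∘ (η dist (T₀ V) ∘ T₁ (η dist V))) ∘ T₁ (T₁ e) ≈⟨ assoc ⟩
        B₁ (mult V) ∘ ((η dist (T₀ V) ∘ T₁ (η dist V)) ∘ T₁ (T₁ e)) ≈⟨ refl⟩∘⟨ distribute-∘ ⟩
        B₁ (mult V) ∘ distribute (distribute e)                    ∎

      ζ∘α : {f : X ⇒ T₀ Z} → ζ ∘ (α ∘ f) ≈ B₁ α ∘ (distribute ζ ∘ f)
      ζ∘α = ≈-trans (pullˡ α-eq) assoc

      α-lift : {k : X ⇒ Z} {m : Y ⇒ Z} {d : X ⇒ F₀ B Y} →
               ζ ∘ k ≈ B₁ m ∘ d → ζ ∘ (α ∘ T₁ k) ≈ B₁ (α ∘ T₁ m) ∘ distribute d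
      α-lift {k = k} {m} {d} p = begin
        ζ ∘ (α ∘ T₁ k)                   ≈⟨ ζ∘α ⟩
        B₁ α ∘ (distribute ζ ∘ T₁ k)     ≈⟨ refl⟩∘⟨ distribute-∘ ⟩
        B₁ α ∘ distribute (ζ ∘ k)        ≈⟨ refl⟩∘⟨ distribute-resp p ⟩
        B₁ α ∘ distribute (B₁ m ∘ d)     ≈⟨ refl⟩∘⟨ distribute-natural ⟩
        B₁ α ∘ (B₁ (T₁ m) ∘ distribute d) ≈⟨ F-pull B ⟩
        B₁ (α ∘ T₁ m) ∘ distribute d     ∎

      -- α is an Eilenberg–Moore algebra: both laws by finality of (Z , ζ).
      α-unit : α ∘ unit Z ≈ id
      α-unit = coalgebra-unique ζ over-ζ (id-compat ≈-refl)
        where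
        over-ζ : ζ ∘ (α ∘ unit Z) ≈ B₁ (α ∘ unit Z) ∘ ζ
        over-ζ = begin
          ζ ∘ (α ∘ unit Z)                 ≈⟨ ζ∘α ⟩
          B₁ α ∘ (distribute ζ ∘ unit Z)   ≈⟨ refl⟩∘⟨ distribute-unit ⟩
          B₁ α ∘ (B₁ (unit Z) ∘ ζ)         ≈⟨ F-pull B ⟩
          B₁ (α ∘ unit Z) ∘ ζ              ∎

      α-mult : α ∘ T₁ α ≈ α ∘ mult Z
      α-mult = coalgebra-unique (distribute (distribute ζ)) (α-lift α-eq) over-dd
        where
        over-dd : ζ ∘ (α ∘ mult Z) ≈ B₁ (α ∘ mult Z) ∘ distribute (distribute ζ)
        over-dd = begin
          ζ ∘ (α ∘ mult Z)                                 ≈⟨ ζ∘α ⟩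
          B₁ α ∘ (distribute ζ ∘ mult Z)                   ≈⟨ refl⟩∘⟨ distribute-mult ⟩
          B₁ α ∘ (B₁ (mult Z) ∘ distribute (distribute ζ)) ≈⟨ F-pull B ⟩
          B₁ (α ∘ mult Z) ∘ distribute (distribute ζ)      ∎

      extension-algebra : (k : Y ⇒ Z) → α ∘ T₁ (α ∘ T₁ k) ≈ (α ∘ T₁ k) ∘ mult Y
      extension-algebra {Y} k = begin
        α ∘ T₁ (α ∘ T₁ k)           ≈⟨ refl⟩∘⟨ homomorphism T ⟩
        α ∘ (T₁ α ∘ T₁ (T₁ k))      ≈⟨ pullˡ α-mult ⟩
        (α ∘ mult Z) ∘ T₁ (T₁ k)    ≈⟨ assoc ⟩
        α ∘ (mult Z ∘ T₁ (T₁ k))    ≈⟨ refl⟩∘⟨ mult-natural k ⟩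
        α ∘ (T₁ k ∘ mult Y)         ≈⟨ ≈-sym assoc ⟩
        (α ∘ T₁ k) ∘ mult Y         ∎

      extension-unit : (k : Y ⇒ Z) → (α ∘ T₁ k) ∘ unit Y ≈ k
      extension-unit {Y} k = begin
        (α ∘ T₁ k) ∘ unit Y    ≈⟨ assoc ⟩
        α ∘ (T₁ k ∘ unit Y)    ≈⟨ refl⟩∘⟨ ≈-sym (unit-natural k) ⟩
        α ∘ (unit Z ∘ k)       ≈⟨ pullˡ α-unit ⟩
        id ∘ k                 ≈⟨ identityˡ ⟩
        k                      ∎

      algebra-morphism-extension : {ψ : T₀ Y ⇒ Z} → α ∘ T₁ ψ ≈ ψ ∘ mult Y →
                                   α ∘ T₁ (ψ ∘ unit Y) ≈ ψ
      algebra-morphism-extension {Y} {ψ} p = begin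
        α ∘ T₁ (ψ ∘ unit Y)          ≈⟨ refl⟩∘⟨ homomorphism T ⟩
        α ∘ (T₁ ψ ∘ T₁ (unit Y))     ≈⟨ pullˡ p ⟩
        (ψ ∘ mult Y) ∘ T₁ (unit Y)   ≈⟨ assoc ⟩
        ψ ∘ (mult Y ∘ T₁ (unit Y))   ≈⟨ refl⟩∘⟨ mult-unitʳ Y ⟩
        ψ ∘ id                       ≈⟨ identityʳ ⟩
        ψ                            ∎

      module _ {X : Obj} (g : X ⇒ F₀ B (T₀ X)) where

        lift : T₀ X ⇒ F₀ B (T₀ X)
        lift = B₁ (mult X) ∘ distribute g

        lift-unit : lift ∘ unit X ≈ g
        lift-unit = begin
          (B₁ (mult X) ∘ distribute g) ∘ unit X     ≈⟨ assoc ⟩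
          B₁ (mult X) ∘ (distribute g ∘ unit X)     ≈⟨ refl⟩∘⟨ distribute-unit ⟩
          B₁ (mult X) ∘ (B₁ (unit (T₀ X)) ∘ g)      ≈⟨ F-pull B ⟩
          B₁ (mult X ∘ unit (T₀ X)) ∘ g             ≈⟨ F-resp-≈ B (mult-unitˡ X) ⟩∘⟨refl ⟩
          B₁ id ∘ g                                 ≈⟨ identity B ⟩∘⟨refl ⟩
          id ∘ g                                    ≈⟨ identityˡ ⟩
          g                                         ∎

        lift-mult : lift ∘ mult X ≈ B₁ (mult X) ∘ distribute lift
        lift-mult = begin
          (B₁ (mult X) ∘ distribute g) ∘ mult X
            ≈⟨ assoc ⟩
          B₁ (mult X) ∘ (distribute g ∘ mult X)
            ≈⟨ refl⟩∘⟨ distribute-mult ⟩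
          B₁ (mult X) ∘ (B₁ (mult (T₀ X)) ∘ distribute (distribute g))
            ≈⟨ F-pull B ⟩
          B₁ (mult X ∘ mult (T₀ X)) ∘ distribute (distribute g)
            ≈⟨ F-resp-≈ B (mult-assoc X) ⟩∘⟨refl ⟩
          B₁ (mult X ∘ T₁ (mult X)) ∘ distribute (distribute g)
            ≈⟨ F-push B ⟩
          B₁ (mult X) ∘ (B₁ (T₁ (mult X)) ∘ distribute (distribute g))
            ≈⟨ refl⟩∘⟨ ≈-sym distribute-natural ⟩
          B₁ (mult X) ∘ distribute lift
            ∎

        h : T₀ X ⇒ Z
        h = proj₁ (final (T₀ X) lift)

        h-coalgebra : ζ ∘ h ≈ B₁ h ∘ lift
        h-coalgebra = proj₁ (proj₂ (final (T₀ X) lift))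

        -- h is a T-algebra morphism: both sides are coalgebra morphisms out of
        -- distribute lift.
        h-algebra : α ∘ T₁ h ≈ h ∘ mult X
        h-algebra = coalgebra-unique (distribute lift) (α-lift h-coalgebra) over-dl
          where
          over-dl : ζ ∘ (h ∘ mult X) ≈ B₁ (h ∘ mult X) ∘ distribute lift
          over-dl = begin
            ζ ∘ (h ∘ mult X)                           ≈⟨ pullˡ h-coalgebra ⟩
            (B₁ h ∘ lift) ∘ mult X                     ≈⟨ assoc ⟩
            B₁ h ∘ (lift ∘ mult X)                     ≈⟨ refl⟩∘⟨ lift-mult ⟩
            B₁ h ∘ (B₁ (mult X) ∘ distribute lift)     ≈⟨ F-pull B ⟩
            B₁ (h ∘ mult X) ∘ distribute lift          ∎

        solution : X ⇒ Z
        solution = h ∘ unit X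

        solution-eq : ζ ∘ solution ≈ B₁ (α ∘ T₁ solution) ∘ g
        solution-eq = begin
          ζ ∘ (h ∘ unit X)             ≈⟨ pullˡ h-coalgebra ⟩
          (B₁ h ∘ lift) ∘ unit X       ≈⟨ assoc ⟩
          B₁ h ∘ (lift ∘ unit X)       ≈⟨ refl⟩∘⟨ lift-unit ⟩
          B₁ h ∘ g                     ≈⟨ F-resp-≈ B (≈-sym (algebra-morphism-extension h-algebra)) ⟩∘⟨refl ⟩
          B₁ (α ∘ T₁ solution) ∘ g     ∎

        -- ... is unique: for any solution k, α ∘ Tk is a coalgebra morphism out
        -- of lift, hence equals h, and k is recovered as (α ∘ Tk) ∘ η.
        solution-unique : (k : X ⇒ Z) → ζ ∘ k ≈ B₁ (α ∘ T₁ k) ∘ g → k ≈ solution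
        solution-unique k p = begin
          k                      ≈⟨ ≈-sym (extension-unit k) ⟩
          (α ∘ T₁ k) ∘ unit X    ≈⟨ coalgebra-unique lift extension-over-lift h-coalgebra ⟩∘⟨refl ⟩
          h ∘ unit X             ∎
          where
          extension-over-lift : ζ ∘ (α ∘ T₁ k) ≈ B₁ (α ∘ T₁ k) ∘ lift
          extension-over-lift = begin
            ζ ∘ (α ∘ T₁ k)                                ≈⟨ α-lift p ⟩
            B₁ (α ∘ T₁ (α ∘ T₁ k)) ∘ distribute g         ≈⟨ F-resp-≈ B (extension-algebra k) ⟩∘⟨refl ⟩
            B₁ ((α ∘ T₁ k) ∘ mult X) ∘ distribute g       ≈⟨ F-push B ⟩
            B₁ (α ∘ T₁ k) ∘ lift                          ∎

      coinduction-up-to : (X : Obj) (g : X ⇒ F₀ B (T₀ X)) →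
        ∃!⇒ C (λ (ĝ : X ⇒ Z) → ζ ∘ ĝ ≈ B₁ α ∘ (B₁ (T₁ ĝ) ∘ g))
      coinduction-up-to X g =
          solution g
        , ≈-trans (solution-eq g) (F-push B)
        , λ k p → solution-unique g k (≈-trans p (F-pull B))

corollary4p3 : ∀ {o ℓ e : Level} (C : Category o ℓ e) (B : Endofunctor C)
    (T : DLObj C B) → IsCompanion C B T →
    (Z : Category.Obj C) (ζ : Category._⇒_ C Z (Endofunctor.F₀ B Z)) →
    IsFinalCoalgebra C B Z ζ →
    let open Category C
        open Endofunctor
        τ = DLObj.lam T
        T′ = DLObj.F T
    in (α : F₀ T′ Z ⇒ Z) →
    ζ ∘ α ≈ F₁ B α ∘ (NatTrans.η τ Z ∘ F₁ T′ ζ) →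
    ∀ (X : Obj) (g : X ⇒ F₀ B (F₀ T′ X)) →
    ∃!⇒ C (λ (ĝ : X ⇒ Z) → ζ ∘ ĝ ≈ F₁ B α ∘ (F₁ B (F₁ T′ ĝ) ∘ g))
corollary4p3 C B T companion Z ζ final α α-eq =
  CoinductionUpTo.coinduction-up-to C B monad Z ζ final α α-eq
  where
  monad : DistributiveMonad C B
  monad = CompanionMonad.companion-monad C B T companion
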